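{- Let $\mathbb{Q}^+$ be the set of positive rational numbers, each written as $a/b$ in lowest terms with $a,b$ coprime positive integers. Define $w:\mathbb{Q}^+\to\mathbb{N}$ by $w(a/b)=a+b$, and $\theta:\mathbb{Q}^+\setminus\{1/1\}\to\mathbb{Q}^+$ by $$\theta\left(\frac{a}{b}\right)=\begin{cases}\dfrac{a-b}{b}, & a>b,\\[4pt] \dfrac{b-a}{a}, & a<b \text{ and } b \text{ even},\\[4pt] \dfrac{a}{b-a}, & a<b \text{ and } b \text{ odd}.\end{cases}$$ Then $w(\theta(x))<w(x)$ for all $x\in\mathbb{Q}^+\setminus\{1/1\}$, and the rooted tree with root $1/1$ in which the parent of each node $x\neq 1/1$ is $\theta(x)$ (equivalently, the tree built from the root $1/1$ by attaching to each node $x$ the elements of $\theta^{ -1}(x)$ as its children) is a rational tree: every positive rational number appears in it exactly once.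
   Context: A rational tree is a rooted tree whose nodes are labeled by $\mathbb{Q}^+$ such that every positive rational number appears exactly once and the children of each node are given by an explicit rule. The map $\theta$ is the composition, with respect to the partition of $\mathbb{Q}^+$ by the parity of the denominator, of the parent maps of the Kepler tree and of the Calkin–Wilf tree. -}

module Defs where

open import Data.Bool using (Bool; true; false; if_then_else_)
open import Data.Nat using (ℕ; zero; suc; _∸_; _+_; _<ᵇ_; _≡ᵇ_; _%_)
open import Data.Integer using (+_; ∣_∣)
open import Data.Rational using (ℚ; _/_; ↥_; ↧ₙ_; 1ℚ; 0ℚ; Positive; _≟_)
open import Relation.Nullary.Decidable using (False)

-- frac n d = n / d (normalised); only used with d > 0 (d = 0 gives a dummy value)
frac : ℕ → ℕ → ℚ
frac n zero    = 0ℚ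
frac n (suc d) = (+ n) / suc d

isEven : ℕ → Bool
isEven b = (b % 2) ≡ᵇ 0

θ-aux : ℕ → ℕ → ℚ
θ-aux a b =
  if b <ᵇ a then frac (a ∸ b) b
  else if a <ᵇ b then (if isEven b then frac (b ∸ a) a else frac a (b ∸ a))
  else 1ℚ   -- a = b, i.e. x = 1/1 : θ is not defined there (dummy value)

θ : ℚ → ℚ
θ x = θ-aux ∣ ↥ x ∣ (↧ₙ x)

w : ℚ → ℕ
w x = ∣ ↥ x ∣ + ↧ₙ x

-- A value of Node x is a node of the tree labelled x
-- (equivalently a path from the root to a node labelled x).
data Node : ℚ → Set where
  root  : Node 1ℚ
  child : ∀ {x} → Positive x → False (x ≟ 1ℚ) → Node (θ x) → Node x

module Submission where

-- Write a positive rational x ≠ 1/1 in lowest terms as a/b, so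
-- a, b > 0 are coprime and a ≠ b.  Each branch of θ replaces the pair (a, b)
-- by a pair of the form {a ∸ b, b}, {b ∸ a, a} or {a, b ∸ a}: one Euclidean
-- subtraction step.  Such a step preserves coprimality and positivity, so the
-- new fraction is already in lowest terms and its weight is simply the sum of
-- the new pair, which is the larger of a, b and hence below a + b.
--
-- The tree statements follow:
-- existence of a node labelled x by following θ from x down to 1/1, with the
-- weight as termination measure; uniqueness because Node x has at most one
-- inhabitant, its constructors being determined by x and carrying only
-- proof-irrelevant data.

open import Defs
open import Data.Nat using (_<_)
open import Data.Rational using (ℚ; Positive; 1ℚ)
open import Data.Product using (Σ; _×_)
open import Relation.Binary.PropositionalEquality using (_≡_; _≢_)

open import Data.Bool using (true; false)
open import Data.Bool.Properties using (T-irrelevant)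
open import Data.Nat using (ℕ; zero; suc; _∸_; _+_; _≤_; _<ᵇ_; z<s)
open import Data.Nat.Properties
  using ( m∸n+n≡m; m<m+n; +-comm; <⇒≤; m<n⇒0<n∸m; ≤-antisym; ≮⇒≥
        ; <ᵇ-reflects-<; <-≤-trans; ≤-pred; ≤-refl; module ≤-Reasoning )
open import Data.Nat.Divisibility using (∣m∸n∣n⇒∣m; ∣-refl)
open import Data.Nat.Coprimality as Coprimality using (Coprime)
open import Data.Integer as ℤ using (+_; -[1+_])
open import Data.Rational using (mkℚ; _≟_)
open import Data.Rational.Properties using (normalize-coprime)
open import Data.Product using (_,_; proj₁; proj₂)
open import Data.Empty using (⊥-elim)
open import Relation.Nullary using (yes; no)
open import Relation.Nullary.Reflects using (ofʸ; ofⁿ)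
open import Relation.Nullary.Decidable using (fromWitnessFalse)
open import Relation.Binary.PropositionalEquality using (refl; sym; cong; subst; subst₂)

-- The Euclidean subtraction step preserves coprimality:
-- a common divisor of a ∸ b and b also divides a.
coprime-∸ : ∀ {a b} → Coprime a b → b ≤ a → Coprime (a ∸ b) b
coprime-∸ c b≤a (i∣a∸b , i∣b) = c (∣m∸n∣n⇒∣m _ b≤a i∣a∸b i∣b , i∣b)

∸-lowers-sum : ∀ {m n} → 0 < m → m ≤ n → (n ∸ m) + m < n + m
∸-lowers-sum {m} {n} 0<m m≤n = begin-strict
  (n ∸ m) + m  ≡⟨ m∸n+n≡m m≤n ⟩
  n            <⟨ m<m+n n 0<m ⟩
  n + m        ∎
  where open ≤-Reasoning

-- A fraction n/d of coprime positive naturals is already in lowest terms,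
-- so it is a positive rational whose weight is n + d.
frac-reduced : ∀ {n d} → Coprime n d → 0 < n → 0 < d →
               Positive (frac n d) × w (frac n d) ≡ n + d
frac-reduced {suc n} {suc d} c _ _ rewrite normalize-coprime {suc n} {d} c = _ , refl

frac-below : ∀ {n d k} → Coprime n d → 0 < n → 0 < d → n + d < k →
             Positive (frac n d) × w (frac n d) < k
frac-below {k = k} c 0<n 0<d n+d<k with frac-reduced c 0<n 0<d
... | positive , weight≡ = positive , subst (_< k) (sym weight≡) n+d<k

θ-aux-descent : ∀ {a b} → Coprime a b → 0 < a → 0 < b → a ≢ b →
                Positive (θ-aux a b) × w (θ-aux a b) < a + b
θ-aux-descent {a} {b} c 0<a 0<b a≢b with b <ᵇ a | <ᵇ-reflects-< b a
... | true | ofʸ b<a =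
  frac-below (coprime-∸ c (<⇒≤ b<a)) (m<n⇒0<n∸m b<a) 0<b
             (∸-lowers-sum 0<b (<⇒≤ b<a))
... | false | ofⁿ b≮a with a <ᵇ b | <ᵇ-reflects-< a b
...   | false | ofⁿ a≮b = ⊥-elim (a≢b (≤-antisym (≮⇒≥ b≮a) (≮⇒≥ a≮b)))
...   | true  | ofʸ a<b with isEven b
...     | true  = frac-below coprime-b∸a-a (m<n⇒0<n∸m a<b) 0<a
                    (subst ((b ∸ a) + a <_) (+-comm b a) lowered)
  where
  coprime-b∸a-a : Coprime (b ∸ a) a
  coprime-b∸a-a = coprime-∸ (Coprimality.sym c) (<⇒≤ a<b)
  lowered : (b ∸ a) + a < b + a
  lowered = ∸-lowers-sum 0<a (<⇒≤ a<b)
...     | false = frac-below (Coprimality.sym coprime-b∸a-a) 0<a (m<n⇒0<n∸m a<b)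
                    (subst₂ _<_ (+-comm (b ∸ a) a) (+-comm b a) lowered)
  where
  coprime-b∸a-a : Coprime (b ∸ a) a
  coprime-b∸a-a = coprime-∸ (Coprimality.sym c) (<⇒≤ a<b)
  lowered : (b ∸ a) + a < b + a
  lowered = ∸-lowers-sum 0<a (<⇒≤ a<b)

-- In lowest terms x = a/b with a ≠ b,
-- since a reduced fraction with a = b has a = b = 1.
θ-descent : (x : ℚ) → Positive x → x ≢ 1ℚ → Positive (θ x) × w (θ x) < w x
θ-descent (mkℚ (+ zero)    _ _) positive _ = ⊥-elim (ℤ.Positive.pos positive)
θ-descent (mkℚ -[1+ _ ]    _ _) positive _ = ⊥-elim (ℤ.Positive.pos positive)
θ-descent (mkℚ (+ suc n) d c) _ x≢1 = θ-aux-descent coprime z<s z<s numerator≢denominator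
  where
  coprime : Coprime (suc n) (suc d)
  coprime = Coprimality.recompute c

  numerator≢denominator : suc n ≢ suc d
  numerator≢denominator refl with coprime (∣-refl , ∣-refl)
  ... | refl = x≢1 refl

-- Existence of a node: following θ from a positive x reaches the root 1/1.
-- The fuel k bounds the weight of x and decreases with it at every θ step.
node-of-weight-below : (k : ℕ) (x : ℚ) → Positive x → w x < k → Node x
node-of-weight-below (suc k) x positive w<k with x ≟ 1ℚ
... | yes refl = root
... | no  x≢1  =
  child positive (fromWitnessFalse x≢1)
        (node-of-weight-below k (θ x) (proj₁ descent)
                              (<-≤-trans (proj₂ descent) (≤-pred w<k)))
  where descent = θ-descent x positive x≢1

positive-irrelevant : ∀ {x} (p q : Positive x) → p ≡ q
positive-irrelevant record { pos = p } record { pos = q } =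
  cong (λ t → record { pos = t }) (T-irrelevant p q)

-- Uniqueness of nodes: any two nodes with the same label are equal, since
-- the root is the only node labelled 1/1 and a child is determined by its
-- (irrelevant) side conditions and, inductively, by its parent node.
node-unique : ∀ {x} (p q : Node x) → q ≡ p
node-unique root            root               = refl
node-unique root            (child _ x≢1 _)    = ⊥-elim x≢1
node-unique (child _ x≢1 _) root               = ⊥-elim x≢1
node-unique {x} (child pos x≢1 parent) (child pos′ x≢1′ parent′)
  with positive-irrelevant {x} pos pos′ | T-irrelevant x≢1 x≢1′
     | node-unique parent parent′
... | refl | refl | refl = refl

theorem21 : ((x : ℚ) → Positive x → x ≢ 1ℚ → Positive (θ x) × w (θ x) < w x)
            × ((x : ℚ) → Positive x → Σ (Node x) (λ p → (q : Node x) → q ≡ p))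
theorem21 = θ-descent , λ x positive →
  node-of-weight-below (suc (w x)) x positive ≤-refl , node-unique _
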